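{- Let $n\ge 2$ be an integer and let $K_n$ be the complete graph on vertex set $[n]=\{1,\ldots,n\}$. Let $r_{\rm BN}\colon\mathbb Z^n\to\mathbb Z$ be its Baker–Norine rank and let $W=\mathfrak m(r_{\rm BN})$ be its weight. Then for every $\mathbf b=(b_1,\ldots,b_{n-2})\in\{0,\ldots,n-1\}^{n-2}$ and every $i\in\mathbb Z$, $$ W(\langle\mathbf b,i\rangle)= \begin{cases} (-1)^\ell\binom{n-2}{\ell} & \text{if } \mathbf b=\mathbf 0 \text{ and } i=n\ell \text{ for some } \ell\in\{0,\ldots,n-2\},\\ 0 & \text{otherwise.} \end{cases} $$
   Context: For $\mathbf d\in\mathbb Z^n$, $\deg(\mathbf d)=d_1+\cdots+d_n$; $\mathbf e_i$ is the $i$-th standard basis vector, and for $I\subseteq[n]$, $\mathbf e_I=\sum_{i\in I}\mathbf e_i$. For a connected graph $G$ without self-loops on ordered vertices $v_1,\ldots,v_n$, let $\Delta_G=D_G-A_G$ be its Laplacian (degree matrix minus adjacency matrix), viewed as a map $\mathbb Z^n\to\mathbb Z^n$. Write $\mathbf d\sim\mathbf d'$ if $\mathbf d-\mathbf d'\in\mathrm{Image}(\Delta_G)$. Let $\mathcal N$ be the set of $\mathbf d\in\mathbb Z^n$ not equivalent to any $\mathbf d'\ge\mathbf 0$ (componentwise). Set $f(\mathbf d)=\min_{\mathbf d'\in\mathcal N}\|\mathbf d-\mathbf d'\|_{1}$ (the $L^1$ norm); the Baker–Norine rank is $r_{\rm BN}=f-1$. The operator $\mathfrak m$ on functions $F\colon\mathbb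 Z^n\to\mathbb Z$ is $(\mathfrak m F)(\mathbf d)=\sum_{I\subseteq[n]}(-1)^{|I|}F(\mathbf d-\mathbf e_I)$; the weight of $r_{\rm BN}$ is $\mathfrak m(r_{\rm BN})$, which equals $\mathfrak m(1+r_{\rm BN})$. For $\mathbf b\in\{0,\ldots,n-1\}^{n-2}$ and $i\in\mathbb Z$, $\langle\mathbf b,i\rangle$ denotes the vector $(b_1,\ldots,b_{n-2},0,\,i-b_1-\cdots-b_{n-2})\in\mathbb Z^n$. -}

module Defs where

open import Data.Nat as ℕ using (ℕ; zero; suc)
open import Data.Integer as ℤ using (ℤ; +_; _-_; _*_; ∣_∣; -1ℤ; 0ℤ; 1ℤ)
open import Data.Fin using (Fin; zero; suc; toℕ; _≟_)
open import Data.Bool using (Bool; true; false; if_then_else_)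
open import Data.Product using (Σ; ∃; _×_)
open import Relation.Nullary using (¬_; does)
open import Relation.Binary.PropositionalEquality using (_≡_)

Vecℤ : ℕ → Set
Vecℤ n = Fin n → ℤ

sumFin : (n : ℕ) → (Fin n → ℤ) → ℤ
sumFin zero    g = 0ℤ
sumFin (suc n) g = g zero ℤ.+ sumFin n (λ j → g (suc j))

sumFinℕ : (n : ℕ) → (Fin n → ℕ) → ℕ
sumFinℕ zero    g = 0
sumFinℕ (suc n) g = g zero ℕ.+ sumFinℕ n (λ j → g (suc j))

record Graph (n : ℕ) : Set where
  field
    adj       : Fin n → Fin n → ℕ
    symmetric : ∀ i j → adj i j ≡ adj j i
    loopless  : ∀ i → adj i i ≡ 0

complete : (n : ℕ) → Graph n
complete n = record
  { adj = λ i j → if does (i ≟ j) then 0 else 1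
  ; symmetric = sym′
  ; loopless = loop′ }
  where
  open import Relation.Binary.PropositionalEquality using (refl)
  open import Relation.Nullary using (yes; no)
  sym′ : ∀ i j → (if does (i ≟ j) then 0 else 1) ≡ (if does (j ≟ i) then 0 else 1)
  sym′ i j with i ≟ j | j ≟ i
  ... | yes _ | yes _ = refl
  ... | no _  | no _  = refl
  ... | yes p | no q  = Data.Empty.⊥-elim (q (Relation.Binary.PropositionalEquality.sym p))
    where import Data.Empty
  ... | no p  | yes q = Data.Empty.⊥-elim (p (Relation.Binary.PropositionalEquality.sym q))
    where import Data.Empty
  loop′ : ∀ i → (if does (i ≟ i) then 0 else 1) ≡ 0
  loop′ i with i ≟ i
  ... | yes _ = refl
  ... | no ¬p = Data.Empty.⊥-elim (¬p refl)
    where import Data.Empty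

laplacian : ∀ {n} → Graph n → Vecℤ n → Vecℤ n
laplacian {n} G x j =
  (+ sumFinℕ n (λ k → Graph.adj G j k)) * x j
    - sumFin n (λ k → (+ Graph.adj G j k) * x k)

_∼[_]_ : ∀ {n} → Vecℤ n → Graph n → Vecℤ n → Set
d ∼[ G ] d′ = ∃ λ x → ∀ j → d j - d′ j ≡ laplacian G x j

NonNeg : ∀ {n} → Vecℤ n → Set
NonNeg d = ∀ j → 0ℤ ℤ.≤ d j

InN : ∀ {n} → Graph n → Vecℤ n → Set
InN G d = ¬ (∃ λ d′ → (d ∼[ G ] d′) × NonNeg d′)

dist₁ : ∀ {n} → Vecℤ n → Vecℤ n → ℤ
dist₁ {n} d d′ = + sumFinℕ n (λ j → ∣ d j - d′ j ∣)

-- F is the function f(d) = min_{d' ∈ 𝒩} ‖d - d'‖₁ (the minimum is attained and is a lower bound)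
IsF : ∀ {n} → Graph n → (Vecℤ n → ℤ) → Set
IsF {n} G F = ∀ d →
  (∃ λ d′ → InN G d′ × F d ≡ dist₁ d d′) ×
  (∀ d′ → InN G d′ → F d ℤ.≤ dist₁ d d′)

IsBNRank : ∀ {n} → Graph n → (Vecℤ n → ℤ) → Set
IsBNRank G r = IsF G (λ d → r d ℤ.+ 1ℤ)

-- sum over all subsets I ⊆ [n], subsets as indicator functions
sumSubsets : (n : ℕ) → ((Fin n → Bool) → ℤ) → ℤ
sumSubsets zero    g = g (λ ())
sumSubsets (suc n) g =
  sumSubsets n (λ s → g (λ { zero → false ; (suc j) → s j })) ℤ.+
  sumSubsets n (λ s → g (λ { zero → true  ; (suc j) → s j }))

card : ∀ {n} → (Fin n → Bool) → ℕ
card {n} s = sumFinℕ n (λ j → if s j then 1 else 0)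

minusE : ∀ {n} → Vecℤ n → (Fin n → Bool) → Vecℤ n
minusE d s j = d j - (if s j then 1ℤ else 0ℤ)

𝔪 : ∀ {n} → (Vecℤ n → ℤ) → Vecℤ n → ℤ
𝔪 {n} F d = sumSubsets n (λ s → (-1ℤ ℤ.^ card s) * F (minusE d s))

-- ⟨b , i⟩ = (b₁,…,b_{m}, 0, i - b₁ - … - b_m) with n = m + 2
bracket : ∀ {m} → (Fin m → ℤ) → ℤ → Vecℤ (suc (suc m))
bracket {zero}  b i zero          = 0ℤ
bracket {zero}  b i (suc zero)    = i
bracket {zero}  b i (suc (suc ()))
bracket {suc m} b i zero          = b zero
bracket {suc m} b i (suc j)       = bracket (λ k → b (suc k)) (i - b zero) j

-- On K_N, a divisor d is equivalent to an effective one iff ψ d c = c + Σⱼ ⌊(d j − c)/N⌋ is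
-- non-negative for some c: firing every vertex ⌊(d j − c)/N⌋ times leaves only remainders mod N,
-- and equivalent divisors have the same ψ up to a shift of c.
-- Hence 1 + r_BN(d) = f d := Σ_{c < N} max(ψ d c + 1, 0). The bound f d ≤ ‖d − d′‖₁ for d′ ∈ 𝒩
-- comes from Hermite's identity for Σ_c ⌊(x − c)/N⌋; it is attained by removing, one at a time,
-- a chip at a vertex j such that ψ d c ≥ 0 for every c ≡ d j (mod N), which lowers f by exactly 1.
-- Removing e_I lowers ψ d c by the number of j ∈ I with d j ≡ c (mod N), so in 𝔪 f the c-th summand
-- cancels unless every d j ≡ c, and is then the N-th backward difference of max(x + 1, 0) at
-- ψ d c, namely (−1)^ℓ C(N−2, ℓ) for ψ d c = ℓ ≥ 0 and 0 otherwise. For d = ⟨b, i⟩ the zero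
-- coordinate leaves only c = 0, which survives exactly when b = 0 and N ∣ i, with ψ d 0 = i / N.

module Submission where

open import Defs
open import Data.Nat as ℕ using (ℕ; zero; suc; _≡ᵇ_)
import Data.Nat.Properties as ℕ
open import Data.Nat.Combinatorics using (_C_; nCk+nC[k+1]≡[n+1]C[k+1]; k>n⇒nCk≡0)
open import Data.Integer
  using (ℤ; +_; -[1+_]; _+_; _-_; _*_; -_; 0ℤ; 1ℤ; -1ℤ; _≤_; _<_; +≤+; +<+; -≤-; -≤+; _⊔_; _^_; ∣_∣)
open import Data.Integer.Properties hiding (_≟_)
open import Data.Integer.DivMod using (_/ℕ_; _%ℕ_; n%ℕd<d; a≡a%ℕn+[a/ℕn]*n; 0≤n⇒0≤n/ℕd)
open import Data.Integer.Tactic.RingSolver using (solve-∀)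
open import Algebra.Properties.AbelianGroup +-0-abelianGroup using (∙-cancelʳ)
open import Algebra.Properties.Semiring.Sum +-*-semiring
  using (sum; sum-syntax; sum-cong-≗; ∑-distrib-+; ∑-comm; *-distribˡ-sum; sum-init-last; sum-replicate-zero)
open import Data.Fin using (Fin; zero; suc; toℕ; fromℕ; fromℕ<; inject₁; _≟_)
open import Data.Fin.Properties
  using (toℕ-injective; toℕ-inject₁; toℕ-fromℕ; toℕ-fromℕ<; toℕ<n; any?; all?; ¬∀⟶∃¬)
open import Data.Bool using (Bool; true; false; if_then_else_; _∧_)
open import Data.Bool.Properties using (¬-not) renaming (_≟_ to _≟ᵇ_)
open import Data.Product using (∃; _×_; _,_; proj₁; proj₂; uncurry)
open import Data.Sum using (_⊎_; inj₁; inj₂)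
open import Data.Empty using (⊥-elim)
open import Function using (_∘_)
open import Relation.Nullary using (¬_; does; yes; no)
open import Relation.Binary.PropositionalEquality
open import Relation.Binary using (tri<; tri≈; tri>)

⟦_⟧ : Bool → ℤ
⟦ b ⟧ = if b then 1ℤ else 0ℤ

sumFin≡sum : ∀ k (g : Fin k → ℤ) → sumFin k g ≡ sum g
sumFin≡sum zero    g = refl
sumFin≡sum (suc k) g = cong (_+_ (g zero)) (sumFin≡sum k (g ∘ suc))

pos-sumFinℕ : ∀ k (g : Fin k → ℕ) → + sumFinℕ k g ≡ ∑[ j < k ] (+ g j)
pos-sumFinℕ zero    g = refl
pos-sumFinℕ (suc k) g = trans (pos-+ (g zero) _) (cong (_+_ (+ g zero)) (pos-sumFinℕ k (g ∘ suc)))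

neg-distrib-sum : ∀ {k} (g : Fin k → ℤ) → - sum g ≡ ∑[ j < k ] (- g j)
neg-distrib-sum {zero}  g = refl
neg-distrib-sum {suc k} g = trans (neg-distrib-+ (g zero) _) (cong (_+_ (- g zero)) (neg-distrib-sum (g ∘ suc)))

sum-distrib-minus : ∀ {k} (g h : Fin k → ℤ) → ∑[ j < k ] (g j - h j) ≡ sum g - sum h
sum-distrib-minus g h = trans (∑-distrib-+ g (-_ ∘ h)) (cong (_+_ (sum g)) (sym (neg-distrib-sum h)))

sum-const : ∀ k a → ∑[ j < k ] a ≡ + k * a
sum-const zero    a = sym (*-zeroˡ a)
sum-const (suc k) a = trans (cong (_+_ a) (sum-const k a)) (sym (suc-* (+ k) a))

sum-mono-≤ : ∀ {k} {g h : Fin k → ℤ} → (∀ j → g j ≤ h j) → sum g ≤ sum h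
sum-mono-≤ {zero}  g≤h = ≤-refl
sum-mono-≤ {suc k} g≤h = +-mono-≤ (g≤h zero) (sum-mono-≤ (g≤h ∘ suc))

sum-nonneg : ∀ {k} {g : Fin k → ℤ} → (∀ j → 0ℤ ≤ g j) → 0ℤ ≤ sum g
sum-nonneg {k} {g} 0≤g = subst (_≤ sum g) (sum-replicate-zero k) (sum-mono-≤ 0≤g)

term≤sum : ∀ {k} {g : Fin k → ℤ} → (∀ j → 0ℤ ≤ g j) → ∀ j → g j ≤ sum g
term≤sum {suc k} {g} 0≤g zero    =
  subst (_≤ sum g) (+-identityʳ (g zero)) (+-monoʳ-≤ (g zero) (sum-nonneg (0≤g ∘ suc)))
term≤sum {suc k} {g} 0≤g (suc j) =
  subst (_≤ sum g) (+-identityˡ (g (suc j))) (+-mono-≤ (0≤g zero) (term≤sum (0≤g ∘ suc) j))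

sum-⊔0-≤ : ∀ {k} (g : Fin k → ℤ) → sum g ⊔ 0ℤ ≤ ∑[ j < k ] (g j ⊔ 0ℤ)
sum-⊔0-≤ {zero}  g = ≤-refl
sum-⊔0-≤ {suc k} g = ⊔-lub (+-mono-≤ (i≤i⊔j (g zero) 0ℤ) (≤-trans (i≤i⊔j _ 0ℤ) ih))
                           (+-mono-≤ (i≤j⊔i (g zero) 0ℤ) (≤-trans (i≤j⊔i _ 0ℤ) ih))
  where ih : sum (g ∘ suc) ⊔ 0ℤ ≤ ∑[ j < k ] (g (suc j) ⊔ 0ℤ)
        ih = sum-⊔0-≤ (g ∘ suc)

sum-indicator : ∀ {k} (j₀ : Fin k) (b : Fin k → Bool) → ∑[ j < k ] ⟦ does (j ≟ j₀) ∧ b j ⟧ ≡ ⟦ b j₀ ⟧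
sum-indicator {suc k} zero     b = trans (cong (_+_ ⟦ b zero ⟧) (sum-replicate-zero k)) (+-identityʳ _)
sum-indicator {suc k} (suc j₀) b = trans (+-identityˡ _) (sum-indicator j₀ (b ∘ suc))

module FloorDiv (n : ℕ) where

  N : ℕ
  N = suc n

  divisible : ℤ → Bool
  divisible y = y %ℕ N ≡ᵇ 0

  %ℕN<N : ∀ y → y %ℕ N ℕ.< N
  %ℕN<N y = n%ℕd<d y N

  divMod : ∀ y → y ≡ + (y %ℕ N) + (y /ℕ N) * + N
  divMod y = a≡a%ℕn+[a/ℕn]*n y N

  private
    +r+q*N-mono : ∀ {q q′ r r′} → r ℕ.< N → q < q′ → + r + q * + N < + r′ + q′ * + N
    +r+q*N-mono {q} {q′} {r} {r′} r<N q<q′ = begin-strict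
      + r + q * + N        <⟨ +-monoˡ-< (q * + N) (+<+ r<N) ⟩
      + N + q * + N        ≡⟨ sym (suc-* q (+ N)) ⟩
      (1ℤ + q) * + N       ≤⟨ *-monoʳ-≤-nonNeg (+ N) (i<j⇒suc[i]≤j q<q′) ⟩
      q′ * + N             ≤⟨ i≤j+i _ (+ r′) ⟩
      + r′ + q′ * + N      ∎
      where open ≤-Reasoning

  divMod-unique : ∀ y q r → r ℕ.< N → y ≡ + r + q * + N → y /ℕ N ≡ q × y %ℕ N ≡ r
  divMod-unique y q r r<N y≡ = q≡ , +-injective (∙-cancelʳ (q * + N) _ _
    (trans (cong (λ z → + (y %ℕ N) + z * + N) (sym q≡)) (trans (sym (divMod y)) y≡)))
    where
    q≡ : y /ℕ N ≡ q
    q≡ with <-cmp (y /ℕ N) q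
    ... | tri< lt _ _ = ⊥-elim (<-irrefl (trans (sym (divMod y)) y≡) (+r+q*N-mono (%ℕN<N y) lt))
    ... | tri≈ _ eq _ = eq
    ... | tri> _ _ gt = ⊥-elim (<-irrefl (trans (sym y≡) (divMod y)) (+r+q*N-mono r<N gt))

  /ℕ-mono-≤ : ∀ {x y} → x ≤ y → x /ℕ N ≤ y /ℕ N
  /ℕ-mono-≤ {x} {y} x≤y = ≮⇒≥ λ y/N<x/N →
    ≤⇒≯ x≤y (subst₂ _<_ (sym (divMod y)) (sym (divMod x)) (+r+q*N-mono (%ℕN<N y) y/N<x/N))

  /ℕ-+-* : ∀ y k → (y + k * + N) /ℕ N ≡ y /ℕ N + k
  /ℕ-+-* y k = proj₁ (divMod-unique (y + k * + N) (y /ℕ N + k) (y %ℕ N) (%ℕN<N y)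
    (trans (cong (_+ k * + N) (divMod y)) (shift (+ (y %ℕ N)) (y /ℕ N) k (+ N))))
    where shift : ∀ r q k m → r + q * m + k * m ≡ r + (q + k) * m
          shift = solve-∀

  divMod-small : ∀ {a} → a ℕ.< N → (+ a) /ℕ N ≡ 0ℤ × (+ a) %ℕ N ≡ a
  divMod-small {a} a<N = divMod-unique (+ a) 0ℤ a a<N (sym (+-identityʳ (+ a)))

  divMod-pred : ∀ y {r} → y %ℕ N ≡ suc r → (y - 1ℤ) /ℕ N ≡ y /ℕ N × (y - 1ℤ) %ℕ N ≡ r
  divMod-pred y {r} eq = divMod-unique (y - 1ℤ) (y /ℕ N) r (ℕ.<-trans (ℕ.n<1+n r) (subst (ℕ._< N) eq (%ℕN<N y)))
    (trans (cong (_- 1ℤ) (trans (divMod y) (cong (λ r → + r + y /ℕ N * + N) eq)))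
           (decrement (+ r) (y /ℕ N * + N)))
    where decrement : ∀ r a → (1ℤ + r) + a - 1ℤ ≡ r + a
          decrement = solve-∀

  /ℕ-pred : ∀ y → (y - 1ℤ) /ℕ N ≡ y /ℕ N - ⟦ divisible y ⟧
  /ℕ-pred y with y %ℕ N in eq
  ... | zero  = proj₁ (divMod-unique (y - 1ℤ) (y /ℕ N - 1ℤ) n ℕ.≤-refl
    (trans (cong (_- 1ℤ) (trans (divMod y) (cong (λ r → + r + y /ℕ N * + N) eq))) (borrow (y /ℕ N) (+ n))))
    where borrow : ∀ q n → + 0 + q * (1ℤ + n) - 1ℤ ≡ n + (q - 1ℤ) * (1ℤ + n)
          borrow = solve-∀
  ... | suc r = trans (proj₁ (divMod-pred y eq)) (sym (+-identityʳ (y /ℕ N)))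

  divisible⇒%ℕ≡0 : ∀ y → divisible y ≡ true → y %ℕ N ≡ 0
  divisible⇒%ℕ≡0 y div with y %ℕ N
  ... | zero = refl

  divisible⇒≡/ℕ*N : ∀ y → divisible y ≡ true → y ≡ y /ℕ N * + N
  divisible⇒≡/ℕ*N y div =
    trans (divMod y) (trans (cong (λ r → + r + y /ℕ N * + N) (divisible⇒%ℕ≡0 y div)) (+-identityˡ _))

  divisible-*N : ∀ k → divisible (k * + N) ≡ true
  divisible-*N k = cong (_≡ᵇ 0) (proj₂ (divMod-unique (k * + N) k 0 (ℕ.s≤s ℕ.z≤n) (sym (+-identityˡ _))))

  divisible-small : ∀ {a} → a ℕ.< N → divisible (+ a) ≡ true → a ≡ 0
  divisible-small {a} a<N div = trans (sym (proj₂ (divMod-small a<N))) (divisible⇒%ℕ≡0 (+ a) div)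

  divisible-neg-small : ∀ {a} → a ℕ.< N → divisible (0ℤ - + a) ≡ true → a ≡ 0
  divisible-neg-small {a} a<N div =
    divisible-small a<N (subst (λ z → divisible z ≡ true) (sym +a≡) (divisible-*N (- q)))
    where
    q : ℤ
    q = (0ℤ - + a) /ℕ N
    negate : ∀ a → a ≡ - (0ℤ - a)
    negate = solve-∀
    neg-distribˡ : ∀ q m → - (q * m) ≡ - q * m
    neg-distribˡ = solve-∀
    +a≡ : + a ≡ - q * + N
    +a≡ = trans (negate (+ a)) (trans (cong -_ (divisible⇒≡/ℕ*N (0ℤ - + a) div)) (neg-distribˡ q (+ N)))

  -- By Hermite's identity floorSum y = y − n; only its unit increments are needed.
  floorSum : ℤ → ℤ
  floorSum y = ∑[ c < N ] ((y - + toℕ c) /ℕ N)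

  floorSum-suc : ∀ y → floorSum (y + 1ℤ) ≡ floorSum y + 1ℤ
  floorSum-suc y = begin
    floorSum (y + 1ℤ)
      ≡⟨ cong₂ _+_ (cong (_/ℕ N) (top y (+ n))) (sum-cong-≗ {n} λ c → cong (_/ℕ N) (lower y (toℕ c))) ⟩
    (y - + n + 1ℤ * + N) /ℕ N + ∑[ c < n ] ((y - + toℕ c) /ℕ N)
      ≡⟨ cong₂ _+_ (trans (/ℕ-+-* (y - + n) 1ℤ) (cong (λ t → (y - + t) /ℕ N + 1ℤ) (sym (toℕ-fromℕ n))))
                   (sum-cong-≗ {n} λ c → cong (λ t → (y - + t) /ℕ N) (sym (toℕ-inject₁ c))) ⟩
    (last + 1ℤ) + init
      ≡⟨ rotate last init ⟩
    (init + last) + 1ℤ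
      ≡⟨ cong (_+ 1ℤ) (sym (sum-init-last {n} (λ c → (y - + toℕ c) /ℕ N))) ⟩
    floorSum y + 1ℤ ∎
    where
    open ≡-Reasoning
    last init : ℤ
    last = (y - + toℕ (fromℕ n)) /ℕ N
    init = ∑[ c < n ] ((y - + toℕ (inject₁ c)) /ℕ N)
    top : ∀ y n → y + 1ℤ - 0ℤ ≡ y - n + 1ℤ * (1ℤ + n)
    top = solve-∀
    lower : ∀ y t → y + 1ℤ - + suc t ≡ y - + t
    lower y t = trans (cong (λ z → y + 1ℤ - z) (pos-+ 1 t)) (shift y (+ t))
      where shift : ∀ y t → y + 1ℤ - (1ℤ + t) ≡ y - t
            shift = solve-∀
    rotate : ∀ a b → a + 1ℤ + b ≡ b + a + 1ℤ
    rotate = solve-∀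

  floorSum-+ : ∀ y k → floorSum (y + + k) ≡ floorSum y + + k
  floorSum-+ y zero    = trans (cong floorSum (+-identityʳ y)) (sym (+-identityʳ (floorSum y)))
  floorSum-+ y (suc k) = begin
    floorSum (y + + suc k)     ≡⟨ cong floorSum (shift y (+ k)) ⟩
    floorSum (y + + k + 1ℤ)    ≡⟨ floorSum-suc (y + + k) ⟩
    floorSum (y + + k) + 1ℤ    ≡⟨ cong (_+ 1ℤ) (floorSum-+ y k) ⟩
    floorSum y + + k + 1ℤ      ≡⟨ sym (shift (floorSum y) (+ k)) ⟩
    floorSum y + + suc k       ∎
    where
    open ≡-Reasoning
    shift : ∀ a k → a + (1ℤ + k) ≡ a + k + 1ℤ
    shift = solve-∀

  sum-divisible≡1 : ∀ y → ∑[ c < N ] ⟦ divisible (y - + toℕ c) ⟧ ≡ 1ℤ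
  sum-divisible≡1 y = begin
    ∑[ c < N ] ⟦ divisible (y - + toℕ c) ⟧
      ≡⟨ sum-cong-≗ {N} (λ c → jump (y - + toℕ c)) ⟩
    ∑[ c < N ] ((y - + toℕ c) /ℕ N - (y - + toℕ c - 1ℤ) /ℕ N)
      ≡⟨ sum-distrib-minus {N} (λ c → (y - + toℕ c) /ℕ N) (λ c → (y - + toℕ c - 1ℤ) /ℕ N) ⟩
    floorSum y - ∑[ c < N ] ((y - + toℕ c - 1ℤ) /ℕ N)
      ≡⟨ cong₂ (λ a b → floorSum a - b) (sym (cancel y)) (sum-cong-≗ {N} λ c → cong (_/ℕ N) (swap y (+ toℕ c))) ⟩
    floorSum (y - 1ℤ + 1ℤ) - floorSum (y - 1ℤ)
      ≡⟨ cong (_- floorSum (y - 1ℤ)) (floorSum-suc (y - 1ℤ)) ⟩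
    floorSum (y - 1ℤ) + 1ℤ - floorSum (y - 1ℤ)
      ≡⟨ cancel′ (floorSum (y - 1ℤ)) ⟩
    1ℤ ∎
    where
    open ≡-Reasoning
    jump : ∀ z → ⟦ divisible z ⟧ ≡ z /ℕ N - (z - 1ℤ) /ℕ N
    jump z = trans (sub (⟦ divisible z ⟧) (z /ℕ N)) (cong (_-_ (z /ℕ N)) (sym (/ℕ-pred z)))
      where sub : ∀ a b → a ≡ b - (b - a)
            sub = solve-∀
    cancel : ∀ y → y - 1ℤ + 1ℤ ≡ y
    cancel = solve-∀
    swap : ∀ y c → y - c - 1ℤ ≡ y - 1ℤ - c
    swap = solve-∀
    cancel′ : ∀ a → a + 1ℤ - a ≡ 1ℤ
    cancel′ = solve-∀

  sum-floor-gap≤∣-∣ : ∀ x y → ∑[ c < N ] (((x - + toℕ c) /ℕ N - (y - + toℕ c) /ℕ N) ⊔ 0ℤ) ≤ + ∣ x - y ∣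
  sum-floor-gap≤∣-∣ x y with ≤-total y x
  ... | inj₁ y≤x = ≤-reflexive (begin
    ∑[ c < N ] (gap c ⊔ 0ℤ)
      ≡⟨ sum-cong-≗ {N} (λ c → i≥j⇒i⊔j≡i (i≤j⇒0≤j-i (/ℕ-mono-≤ (+-monoˡ-≤ (- + toℕ c) y≤x)))) ⟩
    ∑[ c < N ] gap c
      ≡⟨ sum-distrib-minus {N} (λ c → (x - + toℕ c) /ℕ N) (λ c → (y - + toℕ c) /ℕ N) ⟩
    floorSum x - floorSum y
      ≡⟨ cong (λ z → floorSum z - floorSum y) (sym y+∣x-y∣≡x) ⟩
    floorSum (y + + ∣ x - y ∣) - floorSum y
      ≡⟨ cong (_- floorSum y) (floorSum-+ y ∣ x - y ∣) ⟩
    floorSum y + + ∣ x - y ∣ - floorSum y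
      ≡⟨ cancel (floorSum y) _ ⟩
    + ∣ x - y ∣ ∎)
    where
    open ≡-Reasoning
    gap : Fin N → ℤ
    gap c = (x - + toℕ c) /ℕ N - (y - + toℕ c) /ℕ N
    restore : ∀ a b → a + (b - a) ≡ b
    restore = solve-∀
    y+∣x-y∣≡x : y + + ∣ x - y ∣ ≡ x
    y+∣x-y∣≡x = trans (cong (_+_ y) (0≤i⇒+∣i∣≡i (i≤j⇒0≤j-i y≤x))) (restore y x)
    cancel : ∀ a b → a + b - a ≡ b
    cancel = solve-∀
  ... | inj₂ x≤y = ≤-trans (≤-reflexive (trans
      (sum-cong-≗ {N} (λ c → i≤j⇒i⊔j≡j (i≤j⇒i-j≤0 (/ℕ-mono-≤ (+-monoˡ-≤ (- + toℕ c) x≤y)))))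
      (sum-replicate-zero N))) (+≤+ ℕ.z≤n)

sumSubsets-cong : ∀ k {g h : (Fin k → Bool) → ℤ} → (∀ s → g s ≡ h s) → sumSubsets k g ≡ sumSubsets k h
sumSubsets-cong zero    g≡h = g≡h _
sumSubsets-cong (suc k) g≡h = cong₂ _+_ (sumSubsets-cong k (g≡h ∘ _)) (sumSubsets-cong k (g≡h ∘ _))

sumSubsets-distrib-+ : ∀ k (g h : (Fin k → Bool) → ℤ) →
  sumSubsets k (λ s → g s + h s) ≡ sumSubsets k g + sumSubsets k h
sumSubsets-distrib-+ zero    g h = refl
sumSubsets-distrib-+ (suc k) g h = trans (cong₂ _+_ (sumSubsets-distrib-+ k _ _) (sumSubsets-distrib-+ k _ _))
  (+-interchange (sumSubsets k _) (sumSubsets k _) (sumSubsets k _) (sumSubsets k _))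
  where +-interchange : ∀ a b c d → a + b + (c + d) ≡ a + c + (b + d)
        +-interchange = solve-∀

neg-distrib-sumSubsets : ∀ k (g : (Fin k → Bool) → ℤ) → - sumSubsets k g ≡ sumSubsets k (λ s → - g s)
neg-distrib-sumSubsets zero    g = refl
neg-distrib-sumSubsets (suc k) g =
  trans (neg-distrib-+ (sumSubsets k _) (sumSubsets k _))
    (cong₂ _+_ (neg-distrib-sumSubsets k _) (neg-distrib-sumSubsets k _))

sumSubsets-zero : ∀ k → sumSubsets k (λ _ → 0ℤ) ≡ 0ℤ
sumSubsets-zero zero    = refl
sumSubsets-zero (suc k) = cong₂ _+_ (sumSubsets-zero k) (sumSubsets-zero k)

sumSubsets-comm-sum : ∀ k l (g : Fin l → (Fin k → Bool) → ℤ) →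
  sumSubsets k (λ s → ∑[ c < l ] g c s) ≡ ∑[ c < l ] sumSubsets k (g c)
sumSubsets-comm-sum k zero    g = sumSubsets-zero k
sumSubsets-comm-sum k (suc l) g = trans (sumSubsets-distrib-+ k (g zero) _)
  (cong (_+_ (sumSubsets k (g zero))) (sumSubsets-comm-sum k l (g ∘ suc)))

sumSubsets-alternating : ∀ k a → sumSubsets (suc k) (λ s → -1ℤ ^ card s * a) ≡ 0ℤ
sumSubsets-alternating k a = trans
  (cong (_+_ (S λ s → -1ℤ ^ card s * a))
    (trans (sumSubsets-cong k (λ s → flip (-1ℤ ^ card s) a))
           (sym (neg-distrib-sumSubsets k λ s → -1ℤ ^ card s * a))))
  (+-inverseʳ (S λ s → -1ℤ ^ card s * a))
  where
  S : ((Fin k → Bool) → ℤ) → ℤ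
  S = sumSubsets k
  flip : ∀ x a → -1ℤ * x * a ≡ - (x * a)
  flip = solve-∀

𝔪-cong : ∀ {k} {F G : Vecℤ k → ℤ} → (∀ x → F x ≡ G x) → ∀ d → 𝔪 F d ≡ 𝔪 G d
𝔪-cong {k} F≡G d = sumSubsets-cong k (λ s → cong (-1ℤ ^ card s *_) (F≡G _))

𝔪-minus-const : ∀ {k} (F : Vecℤ (suc k) → ℤ) a d → 𝔪 (λ x → F x - a) d ≡ 𝔪 F d
𝔪-minus-const {k} F a d = begin
  𝔪 (λ x → F x - a) d
    ≡⟨ sumSubsets-cong (suc k) (λ s → *-distribˡ-+ (-1ℤ ^ card s) (F (minusE d s)) (- a)) ⟩
  sumSubsets (suc k) (λ s → -1ℤ ^ card s * F (minusE d s) + -1ℤ ^ card s * - a)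
    ≡⟨ sumSubsets-distrib-+ (suc k) (λ s → -1ℤ ^ card s * F (minusE d s)) (λ s → -1ℤ ^ card s * - a) ⟩
  𝔪 F d + sumSubsets (suc k) (λ s → -1ℤ ^ card s * - a)
    ≡⟨ cong (_+_ (𝔪 F d)) (sumSubsets-alternating k (- a)) ⟩
  𝔪 F d + 0ℤ
    ≡⟨ +-identityʳ (𝔪 F d) ⟩
  𝔪 F d ∎
  where open ≡-Reasoning

∇ : ℕ → (ℤ → ℤ) → ℤ → ℤ
∇ zero    G p = G p
∇ (suc k) G p = ∇ k G p - ∇ k G (p - 1ℤ)

altSum : ∀ k → (Fin k → Bool) → (ℤ → ℤ) → ℤ → ℤ
altSum k w G p = sumSubsets k (λ s → -1ℤ ^ card s * G (p - ∑[ j < k ] ⟦ s j ∧ w j ⟧))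

altSum-suc : ∀ k (w : Fin (suc k) → Bool) G p →
  altSum (suc k) w G p ≡ altSum k (w ∘ suc) G p - altSum k (w ∘ suc) G (p - ⟦ w zero ⟧)
altSum-suc k w G p = cong₂ _+_
  (sumSubsets-cong k λ s → cong (λ z → -1ℤ ^ card s * G (p - z)) (+-identityˡ (shared s)))
  (trans (sumSubsets-cong k λ s → flip (card s) (shared s))
         (sym (neg-distrib-sumSubsets k λ s → -1ℤ ^ card s * G (p - ⟦ w zero ⟧ - shared s))))
  where
  shared : (Fin k → Bool) → ℤ
  shared s = ∑[ j < k ] ⟦ s j ∧ w (suc j) ⟧
  flip : ∀ c x → -1ℤ ^ suc c * G (p - (⟦ w zero ⟧ + x)) ≡ - (-1ℤ ^ c * G (p - ⟦ w zero ⟧ - x))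
  flip c x = trans (cong (λ z → -1ℤ ^ suc c * G z) (assoc p ⟦ w zero ⟧ x))
                   (neg-mul (-1ℤ ^ c) (G (p - ⟦ w zero ⟧ - x)))
    where assoc : ∀ p a x → p - (a + x) ≡ p - a - x
          assoc = solve-∀
          neg-mul : ∀ a b → -1ℤ * a * b ≡ - (a * b)
          neg-mul = solve-∀

altSum-missing : ∀ k (w : Fin k → Bool) j → w j ≡ false → ∀ G p → altSum k w G p ≡ 0ℤ
altSum-missing (suc k) w zero    wj≡false G p = begin
  altSum (suc k) w G p                       ≡⟨ altSum-suc k w G p ⟩
  A p - A (p - ⟦ w zero ⟧)                   ≡⟨ cong (λ b → A p - A (p - ⟦ b ⟧)) wj≡false ⟩
  A p - A (p - 0ℤ)                           ≡⟨ cong (λ z → A p - A z) (+-identityʳ p) ⟩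
  A p - A p                                  ≡⟨ +-inverseʳ (A p) ⟩
  0ℤ                                         ∎
  where
  open ≡-Reasoning
  A : ℤ → ℤ
  A = altSum k (w ∘ suc) G
altSum-missing (suc k) w (suc j) wj≡false G p = trans (altSum-suc k w G p) (cong₂ _-_
  (altSum-missing k (w ∘ suc) j wj≡false G p)
  (altSum-missing k (w ∘ suc) j wj≡false G (p - ⟦ w zero ⟧)))

altSum-full : ∀ k (w : Fin k → Bool) → (∀ j → w j ≡ true) → ∀ G p → altSum k w G p ≡ ∇ k G p
altSum-full zero    w _     G p = trans (*-identityˡ (G (p - 0ℤ))) (cong G (+-identityʳ p))
altSum-full (suc k) w full G p = trans (altSum-suc k w G p) (cong₂ _-_
  (altSum-full k (w ∘ suc) (full ∘ suc) G p)
  (trans (cong (λ b → altSum k (w ∘ suc) G (p - ⟦ b ⟧)) (full zero))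
         (altSum-full k (w ∘ suc) (full ∘ suc) G (p - 1ℤ))))

ramp : ℤ → ℤ
ramp x = (x + 1ℤ) ⊔ 0ℤ

ramp-≤-1 : ∀ x → x ≤ -1ℤ → ramp x ≡ 0ℤ
ramp-≤-1 x x≤-1 = i≤j⇒i⊔j≡j (+-monoˡ-≤ 1ℤ x≤-1)

ramp-≥-1 : ∀ x → -1ℤ ≤ x → ramp x ≡ x + 1ℤ
ramp-≥-1 x -1≤x = i≥j⇒i⊔j≡i (+-monoˡ-≤ 1ℤ -1≤x)

0≤ramp : ∀ x → 0ℤ ≤ ramp x
0≤ramp x = i≤j⊔i (x + 1ℤ) 0ℤ

ramp≤gap : ∀ a {b} → b < 0ℤ → ramp a ≤ (a - b) ⊔ 0ℤ
ramp≤gap a {b} b<0 =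
  ⊔-monoˡ-≤ 0ℤ (subst₂ _≤_ (shift a b) (+-identityʳ (a - b)) (+-monoʳ-≤ (a - b) (i<j⇒suc[i]≤j b<0)))
  where shift : ∀ a b → a - b + (1ℤ + b) ≡ a + 1ℤ
        shift = solve-∀

ramp-minus-⟦⟧ : ∀ a b → (b ≡ true → 0ℤ ≤ a) → ramp (a - ⟦ b ⟧) ≡ ramp a - ⟦ b ⟧
ramp-minus-⟦⟧ a false _   = trans (cong ramp (+-identityʳ a)) (sym (+-identityʳ (ramp a)))
ramp-minus-⟦⟧ a true  0≤a = begin
  ramp (a - 1ℤ)     ≡⟨ ramp-≥-1 (a - 1ℤ) (+-monoˡ-≤ -1ℤ (0≤a refl)) ⟩
  a - 1ℤ + 1ℤ       ≡⟨ swap a ⟩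
  a + 1ℤ - 1ℤ       ≡⟨ cong (_- 1ℤ) (sym (ramp-≥-1 a (≤-trans -≤+ (0≤a refl)))) ⟩
  ramp a - 1ℤ       ∎
  where
  open ≡-Reasoning
  swap : ∀ x → x - 1ℤ + 1ℤ ≡ x + 1ℤ - 1ℤ
  swap = solve-∀

-- The m-th backward difference of the indicator function of 0.
signedBinomial : ℕ → ℤ → ℤ
signedBinomial m (+ ℓ)     = -1ℤ ^ ℓ * + (m C ℓ)
signedBinomial m -[1+ _ ] = 0ℤ

signedBinomial-pascal : ∀ m p → signedBinomial m p - signedBinomial m (p - 1ℤ) ≡ signedBinomial (suc m) p
signedBinomial-pascal m (+ zero)    = refl
signedBinomial-pascal m (+ suc ℓ)   = trans (factor (-1ℤ ^ ℓ) (+ (m C suc ℓ)) (+ (m C ℓ)))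
  (cong (λ z → -1ℤ * -1ℤ ^ ℓ * z)
    (trans (sym (pos-+ (m C ℓ) (m C suc ℓ))) (cong +_ (nCk+nC[k+1]≡[n+1]C[k+1] m ℓ))))
  where factor : ∀ x a b → -1ℤ * x * a - x * b ≡ -1ℤ * x * (b + a)
        factor = solve-∀
signedBinomial-pascal m -[1+ k ] = refl

signedBinomial-out-of-range : ∀ m q → (∀ ℓ → ℓ ℕ.≤ m → q ≢ + ℓ) → signedBinomial m q ≡ 0ℤ
signedBinomial-out-of-range m -[1+ _ ] _ = refl
signedBinomial-out-of-range m (+ ℓ) out with ℓ ℕ.≤? m
... | yes ℓ≤m = ⊥-elim (out ℓ ℓ≤m refl)
... | no  ℓ≰m = trans (cong (λ z → -1ℤ ^ ℓ * + z) (k>n⇒nCk≡0 (ℕ.≰⇒> ℓ≰m))) (*-zeroʳ (-1ℤ ^ ℓ))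

∇²-ramp : ∀ p → ∇ 2 ramp p ≡ signedBinomial 0 p
∇²-ramp (+ zero)    = refl
∇²-ramp (+ suc ℓ)   = begin
  (ramp (+ suc ℓ) - ramp (+ ℓ)) - (ramp (+ ℓ) - ramp (+ ℓ - 1ℤ))
    ≡⟨ cong₂ (λ a b → (a - b) - (b - ramp (+ ℓ - 1ℤ))) (ramp-≥-1 (+ suc ℓ) -≤+) (ramp-≥-1 (+ ℓ) -≤+) ⟩
  (+ suc ℓ + 1ℤ - (+ ℓ + 1ℤ)) - (+ ℓ + 1ℤ - ramp (+ ℓ - 1ℤ))
    ≡⟨ cong (λ c → (+ suc ℓ + 1ℤ - (+ ℓ + 1ℤ)) - (+ ℓ + 1ℤ - c)) (ramp-≥-1 (+ ℓ - 1ℤ) (-1≤ℓ-1 ℓ)) ⟩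
  (+ suc ℓ + 1ℤ - (+ ℓ + 1ℤ)) - (+ ℓ + 1ℤ - (+ ℓ - 1ℤ + 1ℤ))
    ≡⟨ linear (+ ℓ) ⟩
  0ℤ
    ≡⟨ sym (*-zeroʳ (-1ℤ ^ suc ℓ)) ⟩
  signedBinomial 0 (+ suc ℓ) ∎
  where
  open ≡-Reasoning
  linear : ∀ x → (1ℤ + x + 1ℤ - (x + 1ℤ)) - (x + 1ℤ - (x - 1ℤ + 1ℤ)) ≡ 0ℤ
  linear = solve-∀
  -1≤ℓ-1 : ∀ ℓ → -1ℤ ≤ + ℓ - 1ℤ
  -1≤ℓ-1 zero    = ≤-refl
  -1≤ℓ-1 (suc ℓ) = -≤+
∇²-ramp -[1+ k ] = trans
  (cong₂ (λ a b → (a - b) - (b - ramp (-[1+ k ] - 1ℤ - 1ℤ)))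
    (ramp-≤-1 -[1+ k ] (-≤- ℕ.z≤n)) (ramp-≤-1 (-[1+ k ] - 1ℤ) (-≤- ℕ.z≤n)))
  (cong (λ c → (0ℤ - 0ℤ) - (0ℤ - c)) (ramp-≤-1 (-[1+ k ] - 1ℤ - 1ℤ) (-≤- ℕ.z≤n)))

∇-ramp : ∀ m p → ∇ (suc (suc m)) ramp p ≡ signedBinomial m p
∇-ramp zero    p = ∇²-ramp p
∇-ramp (suc m) p = trans (cong₂ _-_ (∇-ramp m p) (∇-ramp m (p - 1ℤ))) (signedBinomial-pascal m p)

degree-complete : ∀ k (j : Fin (suc k)) → sumFinℕ (suc k) (Graph.adj (complete (suc k)) j) ≡ k
degree-complete k       zero    = ones k
  where ones : ∀ k → sumFinℕ k (λ _ → 1) ≡ k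
        ones zero    = refl
        ones (suc k) = cong suc (ones k)
degree-complete (suc k) (suc j) = cong suc (degree-complete k j)

sum-neighbours-complete : ∀ k (j : Fin k) (x : Fin k → ℤ) →
  sumFin k (λ l → + Graph.adj (complete k) j l * x l) ≡ sum x - x j
sum-neighbours-complete (suc k) zero    x = trans
  (cong₂ _+_ (*-zeroˡ (x zero)) (trans (sumFin≡sum k _) (sum-cong-≗ {k} λ l → *-identityˡ (x (suc l)))))
  (insert (x zero) (sum (x ∘ suc)))
  where insert : ∀ a b → 0ℤ + b ≡ a + b - a
        insert = solve-∀
sum-neighbours-complete (suc k) (suc j) x = trans
  (cong₂ _+_ (*-identityˡ (x zero)) (sum-neighbours-complete k j (x ∘ suc)))
  (+-assoc-sub (x zero) (sum (x ∘ suc)) (x (suc j)))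
  where +-assoc-sub : ∀ a b c → a + (b - c) ≡ a + b - c
        +-assoc-sub = solve-∀

laplacian-complete : ∀ k (x : Fin (suc k) → ℤ) j → laplacian (complete (suc k)) x j ≡ + suc k * x j - sum x
laplacian-complete k x j = trans
  (cong₂ (λ deg s → + deg * x j - s) (degree-complete k j) (sum-neighbours-complete (suc k) j x))
  (collect (+ k) (x j) (sum x))
  where collect : ∀ k a s → k * a - (s - a) ≡ (1ℤ + k) * a - s
        collect = solve-∀

dist₁-self : ∀ {k} (d : Vecℤ k) → dist₁ d d ≡ 0ℤ
dist₁-self {k} d = trans (pos-sumFinℕ k _)
  (trans (sum-cong-≗ {k} λ j → cong (λ z → + ∣ z ∣) (+-inverseʳ (d j))) (sum-replicate-zero k))

dist₁-triangle : ∀ {k} (d d′ d″ : Vecℤ k) → dist₁ d d″ ≤ dist₁ d d′ + dist₁ d′ d″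
dist₁-triangle {k} d d′ d″ = begin
  dist₁ d d″
    ≡⟨ pos-sumFinℕ k _ ⟩
  ∑[ j < k ] (+ ∣ d j - d″ j ∣)
    ≤⟨ sum-mono-≤ (λ j → triangle (d j) (d′ j) (d″ j)) ⟩
  ∑[ j < k ] (+ ∣ d j - d′ j ∣ + + ∣ d′ j - d″ j ∣)
    ≡⟨ ∑-distrib-+ (λ j → + ∣ d j - d′ j ∣) (λ j → + ∣ d′ j - d″ j ∣) ⟩
  ∑[ j < k ] (+ ∣ d j - d′ j ∣) + ∑[ j < k ] (+ ∣ d′ j - d″ j ∣)
    ≡⟨ sym (cong₂ _+_ (pos-sumFinℕ k _) (pos-sumFinℕ k _)) ⟩
  dist₁ d d′ + dist₁ d′ d″ ∎
  where
  open ≤-Reasoning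
  telescope : ∀ a b c → a - b + (b - c) ≡ a - c
  telescope = solve-∀
  triangle : ∀ a b c → + ∣ a - c ∣ ≤ + ∣ a - b ∣ + + ∣ b - c ∣
  triangle a b c = subst₂ _≤_ (cong (λ z → + ∣ z ∣) (telescope a b c)) (pos-+ ∣ a - b ∣ ∣ b - c ∣)
    (+≤+ (∣i+j∣≤∣i∣+∣j∣ (a - b) (b - c)))

module CompleteGraph (n : ℕ) where
  open FloorDiv n public

  K : Graph N
  K = complete N

  ψ : Vecℤ N → ℤ → ℤ
  ψ d c = c + ∑[ j < N ] ((d j - c) /ℕ N)

  ψ-periodic : ∀ d c k → ψ d (c + k * + N) ≡ ψ d c
  ψ-periodic d c k = begin
    c + k * + N + ∑[ j < N ] ((d j - (c + k * + N)) /ℕ N)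
      ≡⟨ cong (_+_ (c + k * + N)) (sum-cong-≗ {N} λ j →
           trans (cong (_/ℕ N) (shift (d j) c k (+ N))) (/ℕ-+-* (d j - c) (- k))) ⟩
    c + k * + N + ∑[ j < N ] ((d j - c) /ℕ N + - k)
      ≡⟨ cong (_+_ (c + k * + N)) (∑-distrib-+ (λ j → (d j - c) /ℕ N) (λ _ → - k)) ⟩
    c + k * + N + (S + ∑[ j < N ] (- k))
      ≡⟨ cong (λ t → c + k * + N + (S + t)) (sum-const N (- k)) ⟩
    c + k * + N + (S + + N * - k)
      ≡⟨ cancel c k (+ N) S ⟩
    ψ d c ∎
    where
    open ≡-Reasoning
    S : ℤ
    S = ∑[ j < N ] ((d j - c) /ℕ N)
    shift : ∀ a c k m → a - (c + k * m) ≡ a - c + (- k) * m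
    shift = solve-∀
    cancel : ∀ c k m s → c + k * m + (s + m * - k) ≡ c + s
    cancel = solve-∀

  ψ-congruent : ∀ d y c c′ → divisible (y - c) ≡ true → divisible (y - c′) ≡ true → ψ d c′ ≡ ψ d c
  ψ-congruent d y c c′ y≡c y≡c′ = trans (cong (ψ d) c′≡c+kN) (ψ-periodic d c (q - q′))
    where
    open ≡-Reasoning
    q q′ : ℤ
    q = (y - c) /ℕ N
    q′ = (y - c′) /ℕ N
    expand : ∀ y c c′ → c′ ≡ c + ((y - c) - (y - c′))
    expand = solve-∀
    factor : ∀ c q q′ m → c + (q * m - q′ * m) ≡ c + (q - q′) * m
    factor = solve-∀
    c′≡c+kN : c′ ≡ c + (q - q′) * + N
    c′≡c+kN = begin
      c′                                   ≡⟨ expand y c c′ ⟩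
      c + ((y - c) - (y - c′))             ≡⟨ cong₂ (λ u v → c + (u - v))
                                                (divisible⇒≡/ℕ*N (y - c) y≡c) (divisible⇒≡/ℕ*N (y - c′) y≡c′) ⟩
      c + (q * + N - q′ * + N)             ≡⟨ factor c q q′ (+ N) ⟩
      c + (q - q′) * + N                   ∎

  ψ-suc : ∀ d c → ψ d (c + 1ℤ) ≡ ψ d c + 1ℤ - ∑[ j < N ] ⟦ divisible (d j - c) ⟧
  ψ-suc d c = trans
    (cong (_+_ (c + 1ℤ)) (trans
      (sum-cong-≗ {N} λ j → trans (cong (_/ℕ N) (assoc (d j) c)) (/ℕ-pred (d j - c)))
      (sum-distrib-minus {N} (λ j → (d j - c) /ℕ N) (λ j → ⟦ divisible (d j - c) ⟧))))
    (rearrange c _ _)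
    where
    assoc : ∀ a c → a - (c + 1ℤ) ≡ a - c - 1ℤ
    assoc = solve-∀
    rearrange : ∀ c a b → c + 1ℤ + (a - b) ≡ c + a + 1ℤ - b
    rearrange = solve-∀

  ψ-minusE : ∀ d s c → ψ (minusE d s) c ≡ ψ d c - ∑[ j < N ] ⟦ s j ∧ divisible (d j - c) ⟧
  ψ-minusE d s c = trans
    (cong (_+_ c) (trans (sum-cong-≗ {N} pointwise)
      (sum-distrib-minus {N} (λ j → (d j - c) /ℕ N) (λ j → ⟦ s j ∧ divisible (d j - c) ⟧))))
    (+-assoc-sub c _ _)
    where
    +-assoc-sub : ∀ c a b → c + (a - b) ≡ c + a - b
    +-assoc-sub = solve-∀
    pointwise : ∀ j → (minusE d s j - c) /ℕ N ≡ (d j - c) /ℕ N - ⟦ s j ∧ divisible (d j - c) ⟧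
    pointwise j with s j
    ... | true  = trans (cong (_/ℕ N) (swap (d j) c)) (/ℕ-pred (d j - c))
      where swap : ∀ a c → a - 1ℤ - c ≡ a - c - 1ℤ
            swap = solve-∀
    ... | false = trans (cong (λ z → (z - c) /ℕ N) (+-identityʳ (d j))) (sym (+-identityʳ _))

  ψ-laplacian : ∀ d e x → (∀ j → d j - e j ≡ laplacian K x j) → ∀ c → ψ e c ≡ ψ d (c - sum x)
  ψ-laplacian d e x d-e≡Δx c = trans
    (cong (_+_ c) (trans
      (sum-cong-≗ {N} λ j → trans (cong (_/ℕ N) (e≡ j)) (/ℕ-+-* (d j - (c - sum x)) (- x j)))
      (trans (∑-distrib-+ (λ j → (d j - (c - sum x)) /ℕ N) (-_ ∘ x))
             (cong (_+_ (sum λ j → (d j - (c - sum x)) /ℕ N)) (sym (neg-distrib-sum x))))))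
    (rearrange c (sum x) _)
    where
    e≡ : ∀ j → e j - c ≡ d j - (c - sum x) + - x j * + N
    e≡ j = trans (cong (_- c) (sym (subtract (d j) (e j)))) (trans
      (cong (λ z → d j - z - c) (trans (d-e≡Δx j) (laplacian-complete n x j)))
      (solve-e (d j) (x j) (sum x) c (+ N)))
      where
      subtract : ∀ d e → d - (d - e) ≡ e
      subtract = solve-∀
      solve-e : ∀ d a s c m → d - (m * a - s) - c ≡ d - (c - s) + - a * m
      solve-e = solve-∀
    rearrange : ∀ c s a → c + (a + - s) ≡ c - s + a
    rearrange = solve-∀

  -- Fire vertex j ⌊(d j − c)/N⌋ times, vertex 0 ψ d c times fewer: on K_N this leaves (d j − c) mod N
  -- at every vertex, plus N · ψ d c at vertex 0.
  effective-if-ψ≥0 : ∀ d c → 0ℤ ≤ ψ d c → ∃ λ e → (d ∼[ K ] e) × NonNeg e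
  effective-if-ψ≥0 d c 0≤ψ = e , (x , λ j → subtract (d j) (laplacian K x j)) , e≥0
    where
    subtract : ∀ a b → a - (a - b) ≡ b
    subtract = solve-∀
    x : Fin N → ℤ
    x zero    = (d zero - c) /ℕ N - ψ d c
    x (suc j) = (d (suc j) - c) /ℕ N
    sum-x : sum x ≡ - c
    sum-x = cancel ((d zero - c) /ℕ N) c (sum (x ∘ suc))
      where cancel : ∀ a c s → a - (c + (a + s)) + s ≡ - c
            cancel = solve-∀
    e : Vecℤ N
    e j = d j - laplacian K x j
    e≡ : ∀ j → e j ≡ d j - c - + N * x j
    e≡ j = trans (cong (λ z → d j - z) (trans (laplacian-complete n x j) (cong (λ z → + N * x j - z) sum-x)))
      (rearrange (d j) (+ N * x j) c)
      where rearrange : ∀ a b c → a - (b - - c) ≡ a - c - b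
            rearrange = solve-∀
    e≥0 : NonNeg e
    e≥0 zero    = subst (0ℤ ≤_) (sym e₀≡) (+-mono-≤ (+≤+ ℕ.z≤n) (*-monoʳ-≤-nonNeg (+ N) 0≤ψ))
      where
      y : ℤ
      y = d zero - c
      remainder : ∀ r q p m → r + q * m - m * (q - p) ≡ r + p * m
      remainder = solve-∀
      e₀≡ : e zero ≡ + (y %ℕ N) + ψ d c * + N
      e₀≡ = trans (e≡ zero) (trans (cong (λ z → z - + N * x zero) (divMod y))
        (remainder (+ (y %ℕ N)) (y /ℕ N) (ψ d c) (+ N)))
    e≥0 (suc j) = subst (0ℤ ≤_) (sym eⱼ≡) (+≤+ ℕ.z≤n)
      where
      y : ℤ
      y = d (suc j) - c
      remainder : ∀ r q m → r + q * m - m * q ≡ r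
      remainder = solve-∀
      eⱼ≡ : e (suc j) ≡ + (y %ℕ N)
      eⱼ≡ = trans (e≡ (suc j)) (trans (cong (λ z → z - + N * x (suc j)) (divMod y))
        (remainder (+ (y %ℕ N)) (y /ℕ N) (+ N)))

  ψ<0-if-InN : ∀ d → InN K d → ∀ c → ψ d c < 0ℤ
  ψ<0-if-InN d d∈𝒩 c with ψ d c <? 0ℤ
  ... | yes ψ<0 = ψ<0
  ... | no  ψ≮0 = ⊥-elim (d∈𝒩 (effective-if-ψ≥0 d c (≮⇒≥ ψ≮0)))

  ψ-reduce : ∀ d c → ψ d c ≡ ψ d (+ toℕ (fromℕ< (%ℕN<N c)))
  ψ-reduce d c = trans (cong (ψ d) (divMod c))
    (trans (ψ-periodic d (+ (c %ℕ N)) (c /ℕ N)) (cong (λ t → ψ d (+ t)) (sym (toℕ-fromℕ< (%ℕN<N c)))))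

  InN-if-ψ<0 : ∀ d → (∀ (c : Fin N) → ψ d (+ toℕ c) < 0ℤ) → InN K d
  InN-if-ψ<0 d ψ<0 (e , (x , d-e≡Δx) , e≥0) = <⇒≱ (ψ<0 _) (begin
    0ℤ                                     ≤⟨ ψ-nonneg ⟩
    ψ e 0ℤ                                 ≡⟨ ψ-laplacian d e x d-e≡Δx 0ℤ ⟩
    ψ d (0ℤ - sum x)                       ≡⟨ ψ-reduce d (0ℤ - sum x) ⟩
    ψ d (+ toℕ (fromℕ< (%ℕN<N (0ℤ - sum x)))) ∎)
    where
    open ≤-Reasoning
    ψ-nonneg : 0ℤ ≤ ψ e 0ℤ
    ψ-nonneg = subst (0ℤ ≤_) (sym (+-identityˡ _)) (sum-nonneg λ j →
      0≤n⇒0≤n/ℕd (e j - 0ℤ) N (subst (0ℤ ≤_) (sym (+-identityʳ (e j))) (e≥0 j)))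

  f : Vecℤ N → ℤ
  f d = ∑[ c < N ] ramp (ψ d (+ toℕ c))

  0≤f : ∀ d → 0ℤ ≤ f d
  0≤f d = sum-nonneg {N} (λ c → 0≤ramp (ψ d (+ toℕ c)))

  f≤dist₁ : ∀ d d′ → InN K d′ → f d ≤ dist₁ d d′
  f≤dist₁ d d′ d′∈𝒩 = begin
    f d
      ≤⟨ sum-mono-≤ {N} (λ c → ramp≤gap (ψ d (+ toℕ c)) (ψ<0-if-InN d′ d′∈𝒩 (+ toℕ c))) ⟩
    ∑[ c < N ] ((ψ d (+ toℕ c) - ψ d′ (+ toℕ c)) ⊔ 0ℤ)
      ≡⟨ sum-cong-≗ {N} (λ c → cong (_⊔ 0ℤ) (ψ-difference (+ toℕ c))) ⟩
    ∑[ c < N ] (∑[ j < N ] gap j c ⊔ 0ℤ)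
      ≤⟨ sum-mono-≤ {N} (λ c → sum-⊔0-≤ (λ j → gap j c)) ⟩
    ∑[ c < N ] ∑[ j < N ] (gap j c ⊔ 0ℤ)
      ≡⟨ ∑-comm (λ c j → gap j c ⊔ 0ℤ) ⟩
    ∑[ j < N ] ∑[ c < N ] (gap j c ⊔ 0ℤ)
      ≤⟨ sum-mono-≤ {N} (λ j → sum-floor-gap≤∣-∣ (d j) (d′ j)) ⟩
    ∑[ j < N ] (+ ∣ d j - d′ j ∣)
      ≡⟨ sym (pos-sumFinℕ N λ j → ∣ d j - d′ j ∣) ⟩
    dist₁ d d′ ∎
    where
    open ≤-Reasoning
    gap : Fin N → Fin N → ℤ
    gap j c = (d j - + toℕ c) /ℕ N - (d′ j - + toℕ c) /ℕ N
    ψ-difference : ∀ c → ψ d c - ψ d′ c ≡ ∑[ j < N ] ((d j - c) /ℕ N - (d′ j - c) /ℕ N)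
    ψ-difference c = trans (cancel c (sum λ j → (d j - c) /ℕ N) (sum λ j → (d′ j - c) /ℕ N))
      (sym (sum-distrib-minus {N} (λ j → (d j - c) /ℕ N) (λ j → (d′ j - c) /ℕ N)))
      where cancel : ∀ c a b → c + a - (c + b) ≡ a - b
            cancel = solve-∀

  ChipRemovable : Vecℤ N → Fin N → Set
  ChipRemovable d j = ∀ c → divisible (d j - c) ≡ true → 0ℤ ≤ ψ d c

  -- Raise c until some d j ≡ c (mod N); until then ψ d grows by one at each step.
  removable-chip : ∀ d c → 0ℤ ≤ ψ d c → ∃ (ChipRemovable d)
  removable-chip d c = search ((d zero - c) %ℕ N) c refl
    where
    search : ∀ t c → (d zero - c) %ℕ N ≡ t → 0ℤ ≤ ψ d c → ∃ (ChipRemovable d)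
    search t c eq 0≤ψ with any? (λ j → divisible (d j - c) ≟ᵇ true)
    ... | yes (j , dj≡c) = j , λ c′ dj≡c′ → subst (0ℤ ≤_) (sym (ψ-congruent d (d j) c c′ dj≡c dj≡c′)) 0≤ψ
    ... | no none = next t eq
      where
      none-divisible : ∀ j → ⟦ divisible (d j - c) ⟧ ≡ 0ℤ
      none-divisible j = cong ⟦_⟧ (¬-not λ dj≡c → none (j , dj≡c))
      ψ-next : ψ d (c + 1ℤ) ≡ ψ d c + 1ℤ
      ψ-next = trans (ψ-suc d c) (trans
        (cong (_-_ (ψ d c + 1ℤ)) (trans (sum-cong-≗ {N} none-divisible) (sum-replicate-zero N)))
        (+-identityʳ (ψ d c + 1ℤ)))
      next : ∀ t → (d zero - c) %ℕ N ≡ t → ∃ (ChipRemovable d)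
      next zero    eq = ⊥-elim (none (zero , cong (_≡ᵇ 0) eq))
      next (suc t) eq = search t (c + 1ℤ)
        (trans (cong (_%ℕ N) (assoc (d zero) c)) (proj₂ (divMod-pred (d zero - c) eq)))
        (subst (0ℤ ≤_) (sym ψ-next) (≤-trans 0≤ψ (i≤i+j (ψ d c) 1ℤ)))
        where assoc : ∀ a c → a - (c + 1ℤ) ≡ a - c - 1ℤ
              assoc = solve-∀

  ⁅_⁆ : Fin N → Fin N → Bool
  ⁅ j₀ ⁆ j = does (j ≟ j₀)

  f-remove-chip : ∀ d j₀ → ChipRemovable d j₀ → f (minusE d ⁅ j₀ ⁆) ≡ f d - 1ℤ
  f-remove-chip d j₀ removable = begin
    ∑[ c < N ] ramp (ψ (minusE d ⁅ j₀ ⁆) (+ toℕ c))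
      ≡⟨ sum-cong-≗ {N} (λ c → cong ramp (trans (ψ-minusE d ⁅ j₀ ⁆ (+ toℕ c))
           (cong (_-_ (ψ d (+ toℕ c))) (sum-indicator j₀ λ j → divisible (d j - + toℕ c))))) ⟩
    ∑[ c < N ] ramp (ψ d (+ toℕ c) - ⟦ divisible (d j₀ - + toℕ c) ⟧)
      ≡⟨ sum-cong-≗ {N} (λ c → ramp-minus-⟦⟧ (ψ d (+ toℕ c)) _ (removable (+ toℕ c))) ⟩
    ∑[ c < N ] (ramp (ψ d (+ toℕ c)) - ⟦ divisible (d j₀ - + toℕ c) ⟧)
      ≡⟨ sum-distrib-minus {N} (λ c → ramp (ψ d (+ toℕ c))) (λ c → ⟦ divisible (d j₀ - + toℕ c) ⟧) ⟩
    f d - ∑[ c < N ] ⟦ divisible (d j₀ - + toℕ c) ⟧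
      ≡⟨ cong (_-_ (f d)) (sum-divisible≡1 (d j₀)) ⟩
    f d - 1ℤ ∎
    where open ≡-Reasoning

  dist₁-remove-chip : ∀ d j₀ → dist₁ d (minusE d ⁅ j₀ ⁆) ≡ 1ℤ
  dist₁-remove-chip d j₀ = trans (pos-sumFinℕ N λ j → ∣ d j - minusE d ⁅ j₀ ⁆ j ∣)
    (trans (sum-cong-≗ {N} λ j → unit (d j) (⁅ j₀ ⁆ j)) (sum-indicator j₀ λ _ → true))
    where
    cancel : ∀ a → a - (a - 1ℤ) ≡ 1ℤ
    cancel = solve-∀
    unit : ∀ a b → + ∣ a - (a - ⟦ b ⟧) ∣ ≡ ⟦ b ∧ true ⟧
    unit a false = cong (λ z → + ∣ z ∣) (trans (cong (_-_ a) (+-identityʳ a)) (+-inverseʳ a))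
    unit a true  = cong (λ z → + ∣ z ∣) (cancel a)

  ψ<0-if-f≡0 : ∀ d → f d ≡ 0ℤ → ∀ (c : Fin N) → ψ d (+ toℕ c) < 0ℤ
  ψ<0-if-f≡0 d f≡0 c with ψ d (+ toℕ c) <? 0ℤ
  ... | yes ψ<0 = ψ<0
  ... | no  ψ≮0 = ⊥-elim (<⇒≱ (+<+ (ℕ.s≤s ℕ.z≤n)) (begin
    1ℤ                       ≤⟨ +-monoˡ-≤ 1ℤ (≮⇒≥ ψ≮0) ⟩
    ψ d (+ toℕ c) + 1ℤ       ≡⟨ sym (ramp-≥-1 _ (≤-trans -≤+ (≮⇒≥ ψ≮0))) ⟩
    ramp (ψ d (+ toℕ c))     ≤⟨ term≤sum {N} (λ c → 0≤ramp (ψ d (+ toℕ c))) c ⟩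
    f d                      ≡⟨ f≡0 ⟩
    0ℤ                       ∎))
    where open ≤-Reasoning

  ψ≥0-if-f≢0 : ∀ d → f d ≢ 0ℤ → ∃ λ (c : Fin N) → 0ℤ ≤ ψ d (+ toℕ c)
  ψ≥0-if-f≢0 d f≢0 with any? (λ (c : Fin N) → 0ℤ ≤? ψ d (+ toℕ c))
  ... | yes found = found
  ... | no  none  = ⊥-elim (f≢0 (trans
    (sum-cong-≗ {N} λ c → ramp-≤-1 _ (i<j⇒i≤pred[j] (≰⇒> λ 0≤ψ → none (c , 0≤ψ))))
    (sum-replicate-zero N)))

  f-attained : ∀ k d → f d ≡ + k → ∃ λ d′ → InN K d′ × dist₁ d d′ ≤ + k
  f-attained zero    d f≡0   = d , InN-if-ψ<0 d (ψ<0-if-f≡0 d f≡0) , ≤-reflexive (dist₁-self d)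
  f-attained (suc k) d f≡1+k with ψ≥0-if-f≢0 d (λ f≡0 → +[1+n]≢0 (trans (sym f≡1+k) f≡0))
    where +[1+n]≢0 : + suc k ≢ 0ℤ
          +[1+n]≢0 ()
  ... | c , 0≤ψ with removable-chip d (+ toℕ c) 0≤ψ
  ... | j₀ , removable with f-attained k (minusE d ⁅ j₀ ⁆) (trans (f-remove-chip d j₀ removable) (cong (_- 1ℤ) f≡1+k))
  ... | d′ , d′∈𝒩 , dist≤k = d′ , d′∈𝒩 , (begin
    dist₁ d d′                 ≤⟨ dist₁-triangle d d₁ d′ ⟩
    dist₁ d d₁ + dist₁ d₁ d′   ≡⟨ cong (_+ dist₁ d₁ d′) (dist₁-remove-chip d j₀) ⟩
    1ℤ + dist₁ d₁ d′           ≤⟨ +-monoʳ-≤ 1ℤ dist≤k ⟩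
    + suc k                    ∎)
    where
    open ≤-Reasoning
    d₁ : Vecℤ N
    d₁ = minusE d ⁅ j₀ ⁆

  rank≡f-1 : ∀ r → IsBNRank K r → ∀ d → r d ≡ f d - 1ℤ
  rank≡f-1 r isRank d with isRank d | f-attained ∣ f d ∣ d (sym (0≤i⇒+∣i∣≡i (0≤f d)))
  ... | (d′ , d′∈𝒩 , r+1≡dist) , r+1-minimal | d″ , d″∈𝒩 , dist≤f =
    trans (sym (add-sub (r d))) (cong (_- 1ℤ) (≤-antisym
      (≤-trans (r+1-minimal d″ d″∈𝒩) (≤-trans dist≤f (≤-reflexive (0≤i⇒+∣i∣≡i (0≤f d)))))
      (subst (f d ≤_) (sym r+1≡dist) (f≤dist₁ d d′ d′∈𝒩))))
    where add-sub : ∀ a → a + 1ℤ - 1ℤ ≡ a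
          add-sub = solve-∀

  residues : Vecℤ N → Fin N → Fin N → Bool
  residues d c j = divisible (d j - + toℕ c)

  weight≡sum-altSum : ∀ r → IsBNRank K r → ∀ d →
    𝔪 r d ≡ ∑[ c < N ] altSum N (residues d c) ramp (ψ d (+ toℕ c))
  weight≡sum-altSum r isRank d = begin
    𝔪 r d
      ≡⟨ 𝔪-cong (rank≡f-1 r isRank) d ⟩
    𝔪 (λ x → f x - 1ℤ) d
      ≡⟨ 𝔪-minus-const f 1ℤ d ⟩
    sumSubsets N (λ s → -1ℤ ^ card s * ∑[ c < N ] ramp (ψ (minusE d s) (+ toℕ c)))
      ≡⟨ sumSubsets-cong N (λ s → *-distribˡ-sum {N} (-1ℤ ^ card s) λ c → ramp (ψ (minusE d s) (+ toℕ c))) ⟩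
    sumSubsets N (λ s → ∑[ c < N ] (-1ℤ ^ card s * ramp (ψ (minusE d s) (+ toℕ c))))
      ≡⟨ sumSubsets-comm-sum N N (λ c s → -1ℤ ^ card s * ramp (ψ (minusE d s) (+ toℕ c))) ⟩
    ∑[ c < N ] sumSubsets N (λ s → -1ℤ ^ card s * ramp (ψ (minusE d s) (+ toℕ c)))
      ≡⟨ sum-cong-≗ {N} (λ c → sumSubsets-cong N λ s →
           cong (λ z → -1ℤ ^ card s * ramp z) (ψ-minusE d s (+ toℕ c))) ⟩
    ∑[ c < N ] altSum N (residues d c) ramp (ψ d (+ toℕ c)) ∎
    where open ≡-Reasoning

zeroSlot : ∀ m → Fin (suc (suc m))
zeroSlot m = inject₁ (fromℕ m)

bSlot : ∀ {m} → Fin m → Fin (suc (suc m))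
bSlot j = inject₁ (inject₁ j)

bracket-zeroSlot : ∀ m (b : Fin m → ℤ) i → bracket b i (zeroSlot m) ≡ 0ℤ
bracket-zeroSlot zero    b i = refl
bracket-zeroSlot (suc m) b i = bracket-zeroSlot m (b ∘ suc) (i - b zero)

bracket-bSlot : ∀ {m} (b : Fin m → ℤ) i j → bracket b i (bSlot j) ≡ b j
bracket-bSlot b i zero    = refl
bracket-bSlot b i (suc j) = bracket-bSlot (b ∘ suc) (i - b zero) j

bracket-cong : ∀ {m} {b b′ : Fin m → ℤ} → (∀ j → b j ≡ b′ j) → ∀ i j → bracket b i j ≡ bracket b′ i j
bracket-cong {zero}  b≡b′ i zero       = refl
bracket-cong {zero}  b≡b′ i (suc zero) = refl
bracket-cong {suc m} b≡b′ i zero       = b≡b′ zero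
bracket-cong {suc m} {b} {b′} b≡b′ i (suc j) = trans (bracket-cong (b≡b′ ∘ suc) (i - b zero) j)
  (cong (λ z → bracket (b′ ∘ suc) (i - z) j) (b≡b′ zero))

bracket-0-last : ∀ m i → bracket {m} (λ _ → 0ℤ) i (fromℕ (suc m)) ≡ i
bracket-0-last zero    i = refl
bracket-0-last (suc m) i = trans (bracket-0-last m (i - 0ℤ)) (+-identityʳ i)

bracket-0-values : ∀ m i j → bracket {m} (λ _ → 0ℤ) i j ≡ 0ℤ ⊎ bracket {m} (λ _ → 0ℤ) i j ≡ i
bracket-0-values zero    i zero       = inj₁ refl
bracket-0-values zero    i (suc zero) = inj₂ refl
bracket-0-values (suc m) i zero       = inj₁ refl
bracket-0-values (suc m) i (suc j) with bracket-0-values m (i - 0ℤ) j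
... | inj₁ ≡0 = inj₁ ≡0
... | inj₂ ≡i = inj₂ (trans ≡i (+-identityʳ i))

sum-bracket-0 : ∀ m i (g : ℤ → ℤ) → g 0ℤ ≡ 0ℤ → ∑[ j < suc (suc m) ] g (bracket {m} (λ _ → 0ℤ) i j) ≡ g i
sum-bracket-0 zero    i g g0≡0 = trans (cong₂ _+_ g0≡0 (+-identityʳ (g i))) (+-identityˡ (g i))
sum-bracket-0 (suc m) i g g0≡0 = trans (cong₂ _+_ g0≡0 (sum-bracket-0 m (i - 0ℤ) g g0≡0))
  (trans (+-identityˡ _) (cong g (+-identityʳ i)))

module BracketWeight (m : ℕ) (r : Vecℤ (suc (suc m)) → ℤ) (isRank : IsBNRank (complete (suc (suc m))) r)
                     (b : Fin m → Fin (suc (suc m))) (i : ℤ) where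
  open CompleteGraph (suc m)

  d : Vecℤ N
  d = bracket (λ j → + toℕ (b j)) i

  -- The zero coordinate of ⟨b, i⟩ is ≡ c (mod N) only for c = 0, so only that residue contributes.
  weight-bracket : 𝔪 r d ≡ altSum N (residues d zero) ramp (ψ d 0ℤ)
  weight-bracket = trans (weight≡sum-altSum r isRank d) (trans
    (cong (_+_ (altSum N (residues d zero) ramp (ψ d 0ℤ)))
      (trans (sum-cong-≗ {suc m} vanish) (sum-replicate-zero (suc m))))
    (+-identityʳ _))
    where
    residue : ∀ c → residues d (suc c) (zeroSlot m) ≡ false
    residue c = ¬-not λ div → ℕ.1+n≢0 (divisible-neg-small (ℕ.s≤s (toℕ<n c))
      (subst (λ z → divisible (z - + toℕ (suc c)) ≡ true) (bracket-zeroSlot m _ i) div))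
    vanish : ∀ c → altSum N (residues d (suc c)) ramp (ψ d (+ toℕ (suc c))) ≡ 0ℤ
    vanish c = altSum-missing N (residues d (suc c)) (zeroSlot m) (residue c) ramp (ψ d (+ toℕ (suc c)))

  weight-bracket-b≢0 : ∀ j → b j ≢ zero → 𝔪 r d ≡ 0ℤ
  weight-bracket-b≢0 j bj≢0 =
    trans weight-bracket (altSum-missing N (residues d zero) (bSlot j) residue ramp (ψ d 0ℤ))
    where
    coordinate : d (bSlot j) - + 0 ≡ + toℕ (b j)
    coordinate = trans (cong (_- + 0) (bracket-bSlot _ i j)) (+-identityʳ _)
    residue : residues d zero (bSlot j) ≡ false
    residue = ¬-not λ div → bj≢0 (toℕ-injective
      (divisible-small (toℕ<n (b j)) (subst (λ z → divisible z ≡ true) coordinate div)))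

  module _ (b≡0 : ∀ j → b j ≡ zero) where

    d≡ : ∀ j → d j ≡ bracket (λ _ → 0ℤ) i j
    d≡ = bracket-cong (λ j → cong (λ z → + toℕ z) (b≡0 j)) i

    weight-bracket-i≢0 : divisible i ≡ false → 𝔪 r d ≡ 0ℤ
    weight-bracket-i≢0 i≢0 =
      trans weight-bracket (altSum-missing N (residues d zero) (fromℕ (suc m)) residue ramp (ψ d 0ℤ))
      where
      coordinate : d (fromℕ (suc m)) - + 0 ≡ i
      coordinate = trans (cong (_- + 0) (trans (d≡ _) (bracket-0-last m i))) (+-identityʳ i)
      residue : residues d zero (fromℕ (suc m)) ≡ false
      residue = trans (cong divisible coordinate) i≢0

    weight-bracket-diagonal : ∀ q → i ≡ q * + N → 𝔪 r d ≡ signedBinomial m q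
    weight-bracket-diagonal q i≡qN = begin
      𝔪 r d                                       ≡⟨ weight-bracket ⟩
      altSum N (residues d zero) ramp (ψ d 0ℤ)    ≡⟨ altSum-full N (residues d zero) all-divisible ramp (ψ d 0ℤ) ⟩
      ∇ N ramp (ψ d 0ℤ)                           ≡⟨ ∇-ramp m (ψ d 0ℤ) ⟩
      signedBinomial m (ψ d 0ℤ)                   ≡⟨ cong (signedBinomial m) ψ≡q ⟩
      signedBinomial m q                          ∎
      where
      open ≡-Reasoning
      i/N≡q : (i - 0ℤ) /ℕ N ≡ q
      i/N≡q = trans (cong (_/ℕ N) (trans (+-identityʳ i) i≡qN))
        (proj₁ (divMod-unique (q * + N) q 0 (ℕ.s≤s ℕ.z≤n) (sym (+-identityˡ _))))
      ψ≡q : ψ d 0ℤ ≡ q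
      ψ≡q = trans (+-identityˡ _) (trans (sum-cong-≗ {N} λ j → cong (λ z → (z - 0ℤ) /ℕ N) (d≡ j))
        (trans (sum-bracket-0 m i (λ x → (x - 0ℤ) /ℕ N) refl) i/N≡q))
      all-divisible : ∀ j → residues d zero j ≡ true
      all-divisible j with bracket-0-values m i j
      ... | inj₁ ≡0 = cong (λ z → divisible (z - + 0)) (trans (d≡ j) ≡0)
      ... | inj₂ ≡i = trans (cong (λ z → divisible (z - + 0)) (trans (d≡ j) ≡i))
        (trans (cong divisible (trans (+-identityʳ i) i≡qN)) (divisible-*N q))

  +ℓ*N≡+[N*ℓ] : ∀ ℓ → + ℓ * + N ≡ + (N ℕ.* ℓ)
  +ℓ*N≡+[N*ℓ] ℓ = trans (*-comm (+ ℓ) (+ N)) (sym (pos-* N ℓ))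

  weight-bracket-off-diagonal :
    ¬ ((∀ j → b j ≡ zero) × ∃ λ ℓ → ℓ ℕ.≤ m × i ≡ + (N ℕ.* ℓ)) → 𝔪 r d ≡ 0ℤ
  weight-bracket-off-diagonal ¬diagonal with all? (λ j → b j ≟ zero)
  ... | no ¬b≡0 = uncurry weight-bracket-b≢0 (¬∀⟶∃¬ m _ (λ j → b j ≟ zero) ¬b≡0)
  ... | yes b≡0 with i %ℕ N in i%N
  ...   | suc _ = weight-bracket-i≢0 b≡0 (cong (_≡ᵇ 0) i%N)
  ...   | zero  = trans (weight-bracket-diagonal b≡0 (i /ℕ N) i≡qN)
    (signedBinomial-out-of-range m (i /ℕ N) λ ℓ ℓ≤m q≡ℓ →
      ¬diagonal (b≡0 , ℓ , ℓ≤m , trans i≡qN (trans (cong (_* + N) q≡ℓ) (+ℓ*N≡+[N*ℓ] ℓ))))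
    where i≡qN : i ≡ i /ℕ N * + N
          i≡qN = trans (divMod i) (trans (cong (λ r → + r + i /ℕ N * + N) i%N) (+-identityˡ _))

theorem6p17 : (m : ℕ) (r : Vecℤ (suc (suc m)) → ℤ) → IsBNRank (complete (suc (suc m))) r →
    (b : Fin m → Fin (suc (suc m))) (i : ℤ) →
    ((∀ j → b j ≡ zero) → (ℓ : ℕ) → ℓ ℕ.≤ m → i ≡ + (suc (suc m) ℕ.* ℓ) →
        𝔪 r (bracket (λ j → + toℕ (b j)) i) ≡ (-1ℤ ^ ℓ) * + (m C ℓ))
    × (¬ ((∀ j → b j ≡ zero) × ∃ λ ℓ → ℓ ℕ.≤ m × i ≡ + (suc (suc m) ℕ.* ℓ)) →
        𝔪 r (bracket (λ j → + toℕ (b j)) i) ≡ 0ℤ)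
theorem6p17 m r isRank b i =
  (λ b≡0 ℓ _ i≡Nℓ → weight-bracket-diagonal b≡0 (+ ℓ) (trans i≡Nℓ (sym (+ℓ*N≡+[N*ℓ] ℓ)))) ,
  weight-bracket-off-diagonal
  where open BracketWeight m r isRank b i
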